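{- Let $G=(V,E)$ be a connected undirected graph and $T$ a spanning tree of $G$ rooted at $r$. For $F'\subseteq E$ and $v\in V$ let $n_v(F')$ be the number of edges of $F'$ on the tree path in $T$ from $r$ to $v$. Let $s,t\in V$ and $F\subseteq E$. Then $s$ and $t$ are disconnected in $G\setminus F$ if and only if there is an induced edge cut $F'\subseteq F$ such that one of the numbers $n_s(F'),n_t(F')$ is even and the other is odd.
   Context: For $S\subseteq V$, $\delta(S)$ denotes the set of edges with exactly one endpoint in $S$. A set of edges $F'$ is an induced edge cut if $F'=\delta(S)$ for some $S\subseteq V$. -}

module Defs where

open import Data.Nat using (ℕ; suc)
open import Data.Nat.Divisibility using (_∣_)
open import Data.Fin using (Fin)
open import Data.Fin.Subset using (Subset; _∈_; _∉_; _⊆_; ∁; ⊤)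
open import Data.Fin.Subset.Properties using (_∈?_)
open import Data.List using (List; []; _∷_; length; filter)
open import Data.List.Relation.Unary.Unique.Propositional using (Unique)
open import Data.Product using (Σ; _×_)
open import Data.Sum using (_⊎_)
open import Data.Empty using (⊥)
open import Relation.Nullary using (¬_)
open import Relation.Binary.PropositionalEquality using (_≡_)

-- A finite undirected (multi)graph: vertices Fin n, edges Fin m,
-- each edge e has two endpoints end₁ e and end₂ e (order irrelevant).
record Graph : Set where
  field
    n : ℕ
    m : ℕ
    end₁ : Fin m → Fin n
    end₂ : Fin m → Fin n

module _ (G : Graph) where
  open Graph G

  Vertex : Set
  Vertex = Fin n

  EdgeSet : Set
  EdgeSet = Subset m

  Joins : Fin m → Vertex → Vertex → Set
  Joins e x y = (end₁ e ≡ x × end₂ e ≡ y) ⊎ (end₁ e ≡ y × end₂ e ≡ x)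

  data Walk (A : EdgeSet) : Vertex → Vertex → Set where
    [] : ∀ {x} → Walk A x x
    step : ∀ {x y z} (e : Fin m) → e ∈ A → Joins e x y → Walk A y z → Walk A x z

  edges : ∀ {A x y} → Walk A x y → List (Fin m)
  edges [] = []
  edges (step e _ _ w) = e ∷ edges w

  laterVerts : ∀ {A x y} → Walk A x y → List Vertex
  laterVerts [] = []
  laterVerts (step {y = y} _ _ _ w) = y ∷ laterVerts w

  verts : ∀ {A x y} → Walk A x y → List Vertex
  verts {x = x} w = x ∷ laterVerts w

  IsPath : ∀ {A x y} → Walk A x y → Set
  IsPath w = Unique (verts w)

  ConnectedIn : EdgeSet → Vertex → Vertex → Set
  ConnectedIn A x y = Walk A x y

  IsConnected : Set
  IsConnected = ∀ x y → ConnectedIn ⊤ x y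

  IsCycle : ∀ {A x} → Walk A x x → Set
  IsCycle w = (0 Data.Nat.< length (edges w)) × Unique (edges w) × Unique (laterVerts w)

  Acyclic : EdgeSet → Set
  Acyclic A = ∀ x (w : Walk A x x) → ¬ IsCycle w

  IsSpanningTree : EdgeSet → Set
  IsSpanningTree T = (∀ x y → ConnectedIn T x y) × Acyclic T

  countOn : ∀ {A x y} → EdgeSet → Walk A x y → ℕ
  countOn F' w = length (filter (λ e → e ∈? F') (edges w))

  IsDeltaOf : Subset n → EdgeSet → Set
  IsDeltaOf S F' = ∀ e → (e ∈ F' → ExactlyOne e) × (ExactlyOne e → e ∈ F')
    where
    ExactlyOne : Fin m → Set
    ExactlyOne e = (end₁ e ∈ S × end₂ e ∉ S) ⊎ (end₁ e ∉ S × end₂ e ∈ S)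

  IsInducedCut : EdgeSet → Set
  IsInducedCut F' = Σ (Subset n) λ S → IsDeltaOf S F'

  minus : EdgeSet → EdgeSet
  minus F = ∁ F

Even : ℕ → Set
Even k = 2 ∣ k

Odd : ℕ → Set
Odd k = ¬ Even k

{-# OPTIONS --safe #-}
module Submission where

-- An edge of δ(S) is exactly an edge whose endpoints lie on different sides of S, so along any
-- walk from x to y the number of δ(S)-edges is odd iff x and y are on different sides; in
-- particular n_v(δ S) ≡ [r ∈ S] + [v ∈ S] (mod 2), and n_s, n_t differ in parity iff δ(S)
-- separates s from t. If s and t are disconnected in G ∖ F, take S to be the set of vertices
-- that reach t in G ∖ F: then δ(S) ⊆ F and S contains t but not s. Conversely, a walk from s
-- to t in G ∖ F never uses an edge of δ(S) ⊆ F, so s and t lie on the same side of S.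

open import Defs
open import Data.Bool using (Bool; true; false; not; _xor_)
open import Data.Bool.Properties using (not-involutive; xor-assoc; xor-comm; xor-same)
open import Data.Fin using (Fin; _≟_)
open import Data.Fin.Properties using (any?; injective⇒≤)
open import Data.Fin.Subset using (Subset; _∈_; _∉_; _⊆_)
open import Data.Fin.Subset.Properties using (_∈?_; x∈∁p⇒x∉p; x∉∁p⇒x∈p)
open import Data.List using (List; []; _∷_; length; filter; lookup)
open import Data.List.Properties using (filter-reject)
import Data.List.Membership.Propositional as List
import Data.List.Membership.DecPropositional as DecMembership
open import Data.List.Membership.Propositional.Properties using (∈-lookup)
open import Data.List.Relation.Unary.Any using (here; there)
import Data.List.Relation.Unary.All as All
open import Data.List.Relation.Unary.All.Properties using (¬Any⇒All¬)
open import Data.List.Relation.Unary.AllPairs using ([]; _∷_)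
open import Data.List.Relation.Unary.Unique.Propositional using (Unique)
open import Data.Nat using (ℕ; zero; suc; _*_; _≤_; _<_; z≤n; s≤s)
open import Data.Nat.Divisibility using (divides)
open import Data.Nat.Properties using (<⇒≤)
open import Data.Product using (Σ; _×_; _,_; proj₁; proj₂; ∃)
open import Data.Sum using (_⊎_; inj₁; inj₂)
open import Data.Vec using (tabulate)
open import Data.Vec.Properties using (lookup∘tabulate; []=⇒lookup; lookup⇒[]=)
open import Data.Empty using (⊥-elim)
open import Function using (_∘_)
open import Function.Bundles using (mk⇔)
open import Relation.Nullary using (¬_; Dec; yes; no; does)
open import Relation.Nullary.Decidable using (map′; ¬?; _×-dec_; _⊎-dec_; dec-true; dec-false; does-⇔)
open import Relation.Binary.PropositionalEquality
  using (_≡_; refl; sym; trans; cong; cong₂; module ≡-Reasoning)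

open ≡-Reasoning

isOdd : ℕ → Bool
isOdd zero = false
isOdd (suc k) = not (isOdd k)

isOdd-*2 : ∀ q → isOdd (q * 2) ≡ false
isOdd-*2 zero = refl
isOdd-*2 (suc q) = trans (not-involutive _) (isOdd-*2 q)

even⇒isOdd≡false : ∀ {k} → Even k → isOdd k ≡ false
even⇒isOdd≡false (divides q refl) = isOdd-*2 q

isOdd≡false⇒even : ∀ k → isOdd k ≡ false → Even k
isOdd≡false⇒even zero _ = divides 0 refl
isOdd≡false⇒even (suc zero) ()
isOdd≡false⇒even (suc (suc k)) eq
  with divides q refl ← isOdd≡false⇒even k (trans (sym (not-involutive _)) eq)
  = divides (suc q) refl

isOdd≡true⇒odd : ∀ {k} → isOdd k ≡ true → Odd k
isOdd≡true⇒odd eq ev with () ← trans (sym eq) (even⇒isOdd≡false ev)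

odd⇒isOdd≡true : ∀ k → Odd k → isOdd k ≡ true
odd⇒isOdd≡true k odd with isOdd k in eq
... | true = refl
... | false = ⊥-elim (odd (isOdd≡false⇒even k eq))

OppositeParity : ℕ → ℕ → Set
OppositeParity k l = (Even k × Odd l) ⊎ (Odd k × Even l)

xor-isOdd⇒oppositeParity : ∀ k l → isOdd k xor isOdd l ≡ true → OppositeParity k l
xor-isOdd⇒oppositeParity k l eq with isOdd k in ek | isOdd l in el
... | false | true = inj₁ (isOdd≡false⇒even k ek , isOdd≡true⇒odd el)
... | true | false = inj₂ (isOdd≡true⇒odd ek , isOdd≡false⇒even l el)

oppositeParity⇒xor-isOdd : ∀ k l → OppositeParity k l → isOdd k xor isOdd l ≡ true
oppositeParity⇒xor-isOdd k l (inj₁ (ev , odd))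
  rewrite even⇒isOdd≡false ev | odd⇒isOdd≡true l odd = refl
oppositeParity⇒xor-isOdd k l (inj₂ (odd , ev))
  rewrite odd⇒isOdd≡true k odd | even⇒isOdd≡false ev = refl

isOdd-filter-∷ : ∀ {A : Set} {P : A → Set} (P? : ∀ x → Dec (P x)) x xs →
  isOdd (length (filter P? (x ∷ xs))) ≡ does (P? x) xor isOdd (length (filter P? xs))
isOdd-filter-∷ P? x xs with does (P? x)
... | true = refl
... | false = refl

xor-cancel-middle : ∀ a b c → (a xor b) xor (b xor c) ≡ a xor c
xor-cancel-middle a b c = begin
  (a xor b) xor (b xor c) ≡⟨ xor-assoc a b (b xor c) ⟩
  a xor (b xor (b xor c)) ≡⟨ cong (a xor_) (sym (xor-assoc b b c)) ⟩
  a xor ((b xor b) xor c) ≡⟨ cong (λ z → a xor (z xor c)) (xor-same b) ⟩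
  a xor c                 ∎

lookup-injective : ∀ {A : Set} {xs : List A} → Unique xs →
  ∀ {i j} → lookup xs i ≡ lookup xs j → i ≡ j
lookup-injective (_ ∷ _) {Fin.zero} {Fin.zero} _ = refl
lookup-injective (x∉xs ∷ _) {Fin.zero} {Fin.suc j} eq = ⊥-elim (All.lookup x∉xs (∈-lookup j) eq)
lookup-injective (x∉xs ∷ _) {Fin.suc i} {Fin.zero} eq = ⊥-elim (All.lookup x∉xs (∈-lookup i) (sym eq))
lookup-injective (_ ∷ u) {Fin.suc i} {Fin.suc j} eq = cong Fin.suc (lookup-injective u eq)

unique⇒length≤ : ∀ {n} {xs : List (Fin n)} → Unique xs → length xs ≤ n
unique⇒length≤ u = injective⇒≤ (lookup-injective u)

subsetOf : ∀ {n} {P : Fin n → Set} → (∀ x → Dec (P x)) → Subset n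
subsetOf P? = tabulate (does ∘ P?)

∈subsetOf⁺ : ∀ {n} {P : Fin n → Set} (P? : ∀ x → Dec (P x)) {x} → P x → x ∈ subsetOf P?
∈subsetOf⁺ P? {x} px = lookup⇒[]= x _ (trans (lookup∘tabulate (does ∘ P?) x) (dec-true (P? x) px))

∈subsetOf⁻ : ∀ {n} {P : Fin n → Set} (P? : ∀ x → Dec (P x)) {x} → x ∈ subsetOf P? → P x
∈subsetOf⁻ P? {x} x∈ with P? x | trans (sym (lookup∘tabulate (does ∘ P?) x)) ([]=⇒lookup x∈)
... | yes px | _ = px
... | no _ | ()

module WalkParity (G : Graph) where
  open Graph G
  open DecMembership (_≟_ {n}) using () renaming (_∈?_ to _∈ₗ?_)

  len : ∀ {A x y} → Walk G A x y → ℕ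
  len [] = 0
  len (step _ _ _ w) = suc (len w)

  length-verts : ∀ {A x y} (w : Walk G A x y) → length (verts G w) ≡ suc (len w)
  length-verts [] = refl
  length-verts (step _ _ _ w) = cong suc (length-verts w)

  Path : EdgeSet G → Vertex G → Vertex G → Set
  Path A x y = Σ (Walk G A x y) (IsPath G)

  path<n : ∀ {A x y} {p : Walk G A x y} → IsPath G p → len p < n
  path<n {p = p} ip rewrite sym (length-verts p) = unique⇒length≤ ip

  suffixFrom : ∀ {A x y z} (p : Walk G A y z) → IsPath G p → x List.∈ verts G p → Path A x z
  suffixFrom p ip (here refl) = p , ip
  suffixFrom (step _ _ _ p) (_ ∷ ip) (there x∈p) = suffixFrom p ip x∈p

  walk⇒path : ∀ {A x y} → Walk G A x y → Path A x y
  walk⇒path [] = [] , All.[] ∷ []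
  walk⇒path {x = x} (step e e∈A j w) with p , ip ← walk⇒path w | x ∈ₗ? verts G p
  ... | yes x∈p = suffixFrom p ip x∈p
  ... | no x∉p = step e e∈A j p , ¬Any⇒All¬ _ x∉p ∷ ip

  WalkWithin : EdgeSet G → Vertex G → ℕ → Vertex G → Set
  WalkWithin A t k x = Σ (Walk G A x t) λ w → len w ≤ k

  walkWithin? : ∀ A t k x → Dec (WalkWithin A t k x)
  walkWithin? A t zero x = map′ (λ { refl → [] , z≤n }) (λ { ([] , _) → refl }) (x ≟ t)
  walkWithin? A t (suc k) x = map′ fromFirstEdge toFirstEdge
    ((x ≟ t) ⊎-dec any? λ e → (e ∈? A) ×-dec
      (((end₁ e ≟ x) ×-dec walkWithin? A t k (end₂ e)) ⊎-dec ((end₂ e ≟ x) ×-dec walkWithin? A t k (end₁ e))))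
    where
    FirstEdge : Fin m → Set
    FirstEdge e = e ∈ A × ((end₁ e ≡ x × WalkWithin A t k (end₂ e)) ⊎ (end₂ e ≡ x × WalkWithin A t k (end₁ e)))

    fromFirstEdge : (x ≡ t) ⊎ ∃ FirstEdge → WalkWithin A t (suc k) x
    fromFirstEdge (inj₁ refl) = [] , z≤n
    fromFirstEdge (inj₂ (e , e∈A , inj₁ (refl , w , l))) = step e e∈A (inj₁ (refl , refl)) w , s≤s l
    fromFirstEdge (inj₂ (e , e∈A , inj₂ (refl , w , l))) = step e e∈A (inj₂ (refl , refl)) w , s≤s l

    toFirstEdge : WalkWithin A t (suc k) x → (x ≡ t) ⊎ ∃ FirstEdge
    toFirstEdge ([] , _) = inj₁ refl
    toFirstEdge (step e e∈A (inj₁ (refl , refl)) w , s≤s l) = inj₂ (e , e∈A , inj₁ (refl , w , l))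
    toFirstEdge (step e e∈A (inj₂ (refl , refl)) w , s≤s l) = inj₂ (e , e∈A , inj₂ (refl , w , l))

  connected? : ∀ A x t → Dec (ConnectedIn G A x t)
  connected? A x t = map′ proj₁ shortWalk (walkWithin? A t n x)
    where
    shortWalk : Walk G A x t → WalkWithin A t n x
    shortWalk w with p , ip ← walk⇒path w = p , <⇒≤ (path<n ip)

  Separates : Subset n → Vertex G → Vertex G → Set
  Separates S x y = (x ∈ S × y ∉ S) ⊎ (x ∉ S × y ∈ S)

  separates? : ∀ S x y → Dec (Separates S x y)
  separates? S x y = ((x ∈? S) ×-dec ¬? (y ∈? S)) ⊎-dec (¬? (x ∈? S) ×-dec (y ∈? S))

  cut : Subset n → EdgeSet G
  cut S = subsetOf λ e → separates? S (end₁ e) (end₂ e)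

  cut-isDelta : ∀ S → IsDeltaOf G S (cut S)
  cut-isDelta S e = ∈subsetOf⁻ separatesEnds? , ∈subsetOf⁺ separatesEnds?
    where
    separatesEnds? : ∀ e → Dec (Separates S (end₁ e) (end₂ e))
    separatesEnds? e = separates? S (end₁ e) (end₂ e)

  reachSet : EdgeSet G → Vertex G → Subset n
  reachSet A t = subsetOf λ x → connected? A x t

  ∈reachSet⁺ : ∀ {A t x} → ConnectedIn G A x t → x ∈ reachSet A t
  ∈reachSet⁺ {A} {t} = ∈subsetOf⁺ λ x → connected? A x t

  ∈reachSet⁻ : ∀ {A t x} → x ∈ reachSet A t → ConnectedIn G A x t
  ∈reachSet⁻ {A} {t} = ∈subsetOf⁻ λ x → connected? A x t

  cut-reachSet-avoids : ∀ A t {e} → e ∈ cut (reachSet A t) → e ∉ A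
  cut-reachSet-avoids A t {e} e∈cut e∈A with proj₁ (cut-isDelta (reachSet A t) e) e∈cut
  ... | inj₁ (x∈ , y∉) = y∉ (∈reachSet⁺ (step e e∈A (inj₂ (refl , refl)) (∈reachSet⁻ x∈)))
  ... | inj₂ (x∉ , y∈) = x∉ (∈reachSet⁺ (step e e∈A (inj₁ (refl , refl)) (∈reachSet⁻ y∈)))

  χ : Subset n → Vertex G → Bool
  χ S x = does (x ∈? S)

  does-separates? : ∀ S x y → does (separates? S x y) ≡ χ S x xor χ S y
  does-separates? S x y with x ∈? S | y ∈? S
  ... | yes _ | yes _ = refl
  ... | yes _ | no _ = refl
  ... | no _ | yes _ = refl
  ... | no _ | no _ = refl

  crossing : ∀ {S F' e x y} → IsDeltaOf G S F' → Joins G e x y →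
    does (e ∈? F') ≡ χ S x xor χ S y
  crossing {S} {F'} {e} δ (inj₁ (refl , refl)) =
    trans (does-⇔ (mk⇔ (proj₁ (δ e)) (proj₂ (δ e))) (e ∈? F') (separates? S (end₁ e) (end₂ e)))
          (does-separates? S (end₁ e) (end₂ e))
  crossing {S} {F'} {e} δ (inj₂ (refl , refl)) =
    trans (crossing {S} {F'} δ (inj₁ (refl , refl))) (xor-comm (χ S (end₁ e)) (χ S (end₂ e)))

  isOdd-countOn : ∀ {S F' A x y} → IsDeltaOf G S F' → (w : Walk G A x y) →
    isOdd (countOn G F' w) ≡ χ S x xor χ S y
  isOdd-countOn {S} {x = x} δ [] = sym (xor-same (χ S x))
  isOdd-countOn {S} {F'} {x = x} {y} δ (step {y = z} e e∈A j w) = begin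
    isOdd (countOn G F' (step e e∈A j w))            ≡⟨ isOdd-filter-∷ (_∈? F') e (edges G w) ⟩
    does (e ∈? F') xor isOdd (countOn G F' w)        ≡⟨ cong₂ _xor_ (crossing δ j) (isOdd-countOn δ w) ⟩
    (χ S x xor χ S z) xor (χ S z xor χ S y)          ≡⟨ xor-cancel-middle (χ S x) (χ S z) (χ S y) ⟩
    χ S x xor χ S y                                  ∎

  isOdd-countOn-xor : ∀ {S F' A B r s t} → IsDeltaOf G S F' → (p : Walk G A r s) (q : Walk G B r t) →
    isOdd (countOn G F' p) xor isOdd (countOn G F' q) ≡ χ S s xor χ S t
  isOdd-countOn-xor {S} {F'} {r = r} {s} {t} δ p q = begin
    isOdd (countOn G F' p) xor isOdd (countOn G F' q) ≡⟨ cong₂ _xor_ (isOdd-countOn δ p) (isOdd-countOn δ q) ⟩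
    (χ S r xor χ S s) xor (χ S r xor χ S t)           ≡⟨ cong (_xor (χ S r xor χ S t)) (xor-comm (χ S r) (χ S s)) ⟩
    (χ S s xor χ S r) xor (χ S r xor χ S t)           ≡⟨ xor-cancel-middle (χ S s) (χ S r) (χ S t) ⟩
    χ S s xor χ S t                                   ∎

  countOn-disjoint : ∀ {F' A x y} → (∀ {e} → e ∈ A → e ∉ F') → (w : Walk G A x y) → countOn G F' w ≡ 0
  countOn-disjoint _ [] = refl
  countOn-disjoint {F'} disjoint (step e e∈A _ w) =
    trans (cong length (filter-reject (_∈? F') (disjoint e∈A))) (countOn-disjoint disjoint w)

  disjointWalk⇒sameSide : ∀ {S F' A x y} → IsDeltaOf G S F' → (∀ {e} → e ∈ A → e ∉ F') →
    Walk G A x y → χ S x xor χ S y ≡ false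
  disjointWalk⇒sameSide {F' = F'} δ disjoint w =
    trans (sym (isOdd-countOn δ w)) (cong isOdd (countOn-disjoint {F'} disjoint w))

  ParitySeparatingCut : EdgeSet G → Vertex G → Vertex G → Vertex G → EdgeSet G → EdgeSet G → Set
  ParitySeparatingCut T r s t F F' = IsInducedCut G F' × F' ⊆ F ×
    ((ps : Walk G T r s) → IsPath G ps → (pt : Walk G T r t) → IsPath G pt →
      OppositeParity (countOn G F' ps) (countOn G F' pt))

  disconnected⇒paritySeparatingCut : ∀ T r {s t} F → ¬ ConnectedIn G (minus G F) s t →
    Σ (EdgeSet G) (ParitySeparatingCut T r s t F)
  disconnected⇒paritySeparatingCut T r {s} {t} F s↛t = cut S , (S , cut-isDelta S) , cut⊆F , opposite
    where
    S : Subset n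
    S = reachSet (minus G F) t

    cut⊆F : cut S ⊆ F
    cut⊆F e∈cut = x∉∁p⇒x∈p (cut-reachSet-avoids (minus G F) t e∈cut)

    opposite : (ps : Walk G T r s) → IsPath G ps → (pt : Walk G T r t) → IsPath G pt →
      OppositeParity (countOn G (cut S) ps) (countOn G (cut S) pt)
    opposite ps _ pt _ = xor-isOdd⇒oppositeParity _ _ (trans (isOdd-countOn-xor (cut-isDelta S) ps pt)
      (cong₂ _xor_ (dec-false (s ∈? S) (s↛t ∘ ∈reachSet⁻)) (dec-true (t ∈? S) (∈reachSet⁺ []))))

  paritySeparatingCut⇒disconnected : ∀ {T} → (∀ x y → ConnectedIn G T x y) → ∀ r {s t} F →
    Σ (EdgeSet G) (ParitySeparatingCut T r s t F) → ¬ ConnectedIn G (minus G F) s t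
  paritySeparatingCut⇒disconnected spanning r {s} {t} F (F' , (S , δ) , F'⊆F , opposite) w
    with ps , ips ← walk⇒path (spanning r s) | pt , ipt ← walk⇒path (spanning r t)
    with () ← begin
      true                                                ≡⟨ oppositeParity⇒xor-isOdd _ _ (opposite ps ips pt ipt) ⟨
      isOdd (countOn G F' ps) xor isOdd (countOn G F' pt) ≡⟨ isOdd-countOn-xor δ ps pt ⟩
      χ S s xor χ S t                                     ≡⟨ disjointWalk⇒sameSide δ (λ e∈∁F → x∈∁p⇒x∉p e∈∁F ∘ F'⊆F) w ⟩
      false                                               ∎

corollary3p4 : (G : Graph) → IsConnected G →
    (T : EdgeSet G) → IsSpanningTree G T →
    (r s t : Vertex G) (F : EdgeSet G) →
    (¬ ConnectedIn G (minus G F) s t →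
      Σ (EdgeSet G) λ F' → IsInducedCut G F' × F' ⊆ F ×
        ((ps : Walk G T r s) → IsPath G ps → (pt : Walk G T r t) → IsPath G pt →
          (Even (countOn G F' ps) × Odd (countOn G F' pt)) ⊎ (Odd (countOn G F' ps) × Even (countOn G F' pt))))
    ×
    ((Σ (EdgeSet G) λ F' → IsInducedCut G F' × F' ⊆ F ×
        ((ps : Walk G T r s) → IsPath G ps → (pt : Walk G T r t) → IsPath G pt →
          (Even (countOn G F' ps) × Odd (countOn G F' pt)) ⊎ (Odd (countOn G F' ps) × Even (countOn G F' pt))))
      → ¬ ConnectedIn G (minus G F) s t)
corollary3p4 G _ T (spanning , _) r s t F =
  disconnected⇒paritySeparatingCut T r F , paritySeparatingCut⇒disconnected spanning r F
  where open WalkParity G
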